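{- Let $F$ be a forest, $\{M_i\}_{i\in F}$ a collection of MTL-chains sharing the same top element $1$, and $S$ a proper downset of $F$. Then $X_S=\{h\in\bigotimes_{i\in F}M_i: h|_S=1\}$ and $\bigotimes_{i\in F\setminus S}M_i$ are isomorphic semihoops.
   Context: A forest is a poset in which every $\downarrow a$ is totally ordered. MTL-chains are totally ordered bounded integral commutative prelinear residuated lattices; a semihoop is an integral commutative prelinear residuated lattice (not necessarily bounded), with operations $\cdot,\to,\wedge,\vee,1$. The forest product $\bigotimes_{i\in F}M_i$ is the set of functions $h$ with $h(i)\in M_i$ such that $h(i)\ne0_i$ implies $h(j)=1$ for all $j<i$; monoid and lattice operations are pointwise, and $(h\to g)(i)=h(i)\to_ig(i)$ if $h(j)\le_jg(j)$ for all $j<i$, else $0_i$ (for $F\setminus S$ the same construction with the induced order). $X_S$ is a filter of $\bigotimes_{i\in F}M_i$, regarded as a semihoop with the inherited operations. -}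

module Defs where

open import Level using (0ℓ)
open import Data.Bool using (Bool; true; false)
open import Data.Bool.Properties using () renaming (_≟_ to _≟B_)
open import Data.Product using (Σ; _×_; _,_; proj₁; proj₂; ∃)
open import Data.Sum using (_⊎_; inj₁; inj₂)
open import Data.Empty using (⊥; ⊥-elim)
open import Relation.Nullary using (¬_; Dec; yes; no)
import Relation.Binary.PropositionalEquality as PE
open import Relation.Binary.PropositionalEquality using (_≡_; _≢_; refl; sym; trans; cong; cong₂; subst)
open import Relation.Binary.Structures using (IsPartialOrder; IsTotalOrder)
open import Relation.Binary.Lattice.Definitions using (Supremum; Infimum; Exponential)
open import Algebra.Structures using (IsCommutativeMonoid)
open import Axiom.ExcludedMiddle using (ExcludedMiddle)
open import Axiom.UniquenessOfIdentityProofs using (module Decidable⇒UIP)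

record Forest : Set₁ where
  field
    Carrier        : Set
    _≤_            : Carrier → Carrier → Set
    isPartialOrder : IsPartialOrder _≡_ _≤_
    downChain      : ∀ a x y → x ≤ a → y ≤ a → x ≤ y ⊎ y ≤ x

  _<_ : Carrier → Carrier → Set
  j < i = (j ≤ i) × (j ≢ i)

  open IsPartialOrder isPartialOrder public
    using () renaming (trans to ≤-trans; antisym to ≤-antisym; refl to ≤-refl)

  <-trans : ∀ {k j i} → k < j → j < i → k < i
  <-trans {k} {j} {i} (k≤j , k≢j) (j≤i , j≢i) =
    ≤-trans k≤j j≤i , λ k≡i → j≢i (≤-antisym j≤i (subst (_≤ j) k≡i k≤j))

record MTLChain : Set₁ where
  infixl 7 _·_
  infixr 5 _⇒_
  field
    Carrier  : Set
    _≤_      : Carrier → Carrier → Set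
    _·_ _⇒_ _∧_ _∨_ : Carrier → Carrier → Carrier
    1# 0#    : Carrier
    isTotalOrder : IsTotalOrder _≡_ _≤_
    ∧-infimum    : Infimum _≤_ _∧_
    ∨-supremum   : Supremum _≤_ _∨_
    ·-isCommutativeMonoid : IsCommutativeMonoid _≡_ _·_ 1#
    residuated   : Exponential _≤_ _·_ _⇒_   -- w · x ≤ y ⇔ w ≤ x ⇒ y
    top          : ∀ x → x ≤ 1#
    bottom       : ∀ x → 0# ≤ x
    prelinear    : ∀ x y → (x ⇒ y) ∨ (y ⇒ x) ≡ 1#

  open IsTotalOrder isTotalOrder public
    using (total; reflexive) renaming (trans to ≤-trans; antisym to ≤-antisym; refl to ≤-refl)
  open IsCommutativeMonoid ·-isCommutativeMonoid public
    using (comm; identityˡ; identityʳ)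

  ·-zeroˡ : ∀ x → 0# · x ≡ 0#
  ·-zeroˡ x = ≤-antisym (proj₂ (residuated 0# x 0#) (bottom _)) (bottom _)

  ·-zeroʳ : ∀ x → x · 0# ≡ 0#
  ·-zeroʳ x = trans (comm x 0#) (·-zeroˡ x)

  ≤⇒⇒≡1 : ∀ {x y} → x ≤ y → x ⇒ y ≡ 1#
  ≤⇒⇒≡1 {x} {y} x≤y = ≤-antisym (top _)
    (proj₁ (residuated 1# x y) (subst (_≤ y) (sym (identityˡ x)) x≤y))

  ≤0⇒≡0 : ∀ {x} → x ≤ 0# → x ≡ 0#
  ≤0⇒≡0 p = ≤-antisym p (bottom _)

open MTLChain using () renaming (Carrier to ∣_∣)

record SemihoopAlg : Set₁ where
  field
    Carrier : Set
    _≈_     : Carrier → Carrier → Set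
    _·_ _⇒_ _∧_ _∨_ : Carrier → Carrier → Carrier
    1#      : Carrier

record _≅_ (A B : SemihoopAlg) : Set where
  private
    module A = SemihoopAlg A
    module B = SemihoopAlg B
  field
    to      : A.Carrier → B.Carrier
    from    : B.Carrier → A.Carrier
    to-cong   : ∀ {x y} → x A.≈ y → to x B.≈ to y
    from-cong : ∀ {x y} → x B.≈ y → from x A.≈ from y
    from∘to : ∀ x → from (to x) A.≈ x
    to∘from : ∀ y → to (from y) B.≈ y
    to-·    : ∀ x y → to (x A.· y) B.≈ (to x B.· to y)
    to-⇒    : ∀ x y → to (x A.⇒ y) B.≈ (to x B.⇒ to y)
    to-∧    : ∀ x y → to (x A.∧ y) B.≈ (to x B.∧ to y)
    to-∨    : ∀ x y → to (x A.∨ y) B.≈ (to x B.∨ to y)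
    to-1    : to A.1# B.≈ B.1#

-- Forest product ⨂_{i ∈ F} M_i.  The definition of → needs to decide
-- "h(j) ≤ g(j) for all j < i", so it is parametrised by excluded middle.

module ForestProduct (em : ExcludedMiddle 0ℓ) (F : Forest) (M : Forest.Carrier F → MTLChain) where
  open Forest F using (_<_; <-trans) renaming (Carrier to I; _≤_ to _⊑_)
  module M i = MTLChain (M i)

  Fun : Set
  Fun = (i : I) → ∣ M i ∣

  IsProd : Fun → Set
  IsProd h = ∀ i → h i ≢ M.0# i → ∀ j → j < i → h j ≡ M.1# j

  Prod : Set
  Prod = Σ Fun IsProd

  _≈_ : Prod → Prod → Set
  h ≈ g = ∀ i → proj₁ h i ≡ proj₁ g i

  Below : Fun → Fun → I → Set
  Below h g i = ∀ j → j < i → M._≤_ j (h j) (g j)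

  impAt : (h g : Fun) (i : I) → Dec (Below h g i) → ∣ M i ∣
  impAt h g i (yes _) = M._⇒_ i (h i) (g i)
  impAt h g i (no _)  = M.0# i

  _·F_ _⇒F_ _∧F_ _∨F_ : Fun → Fun → Fun
  (h ·F g) i = M._·_ i (h i) (g i)
  (h ∧F g) i = M._∧_ i (h i) (g i)
  (h ∨F g) i = M._∨_ i (h i) (g i)
  (h ⇒F g) i = impAt h g i em

  1F : Fun
  1F i = M.1# i

  private
    ·-nz : ∀ i {x y : ∣ M i ∣} → M._·_ i x y ≢ M.0# i → (x ≢ M.0# i) × (y ≢ M.0# i)
    ·-nz i p = (λ x≡0 → p (trans (cong (λ z → M._·_ i z _) x≡0) (M.·-zeroˡ i _)))
             , (λ y≡0 → p (trans (cong (M._·_ i _) y≡0) (M.·-zeroʳ i _)))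

  ·-closed : ∀ h g → IsProd h → IsProd g → IsProd (h ·F g)
  ·-closed h g ph pg i nz j j<i with ·-nz i nz
  ... | hnz , gnz = trans (cong₂ (M._·_ j) (ph i hnz j j<i) (pg i gnz j j<i)) (M.identityˡ j _)

  ∧-closed : ∀ h g → IsProd h → IsProd g → IsProd (h ∧F g)
  ∧-closed h g ph pg i nz j j<i =
    M.≤-antisym j (M.top j _) (proj₂ (proj₂ (M.∧-infimum j (h j) (g j))) (M.1# j)
      (M.reflexive j (sym (ph i hnz j j<i))) (M.reflexive j (sym (pg i gnz j j<i))))
    where
    hnz : h i ≢ M.0# i
    hnz h0 = nz (M.≤0⇒≡0 i (subst (M._≤_ i _) h0 (proj₁ (M.∧-infimum i (h i) (g i)))))
    gnz : g i ≢ M.0# i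
    gnz g0 = nz (M.≤0⇒≡0 i (subst (M._≤_ i _) g0 (proj₁ (proj₂ (M.∧-infimum i (h i) (g i))))))

  ∨-closed : ∀ h g → IsProd h → IsProd g → IsProd (h ∨F g)
  ∨-closed h g ph pg i nz j j<i with M.total i (h i) (g i)
  ... | inj₁ h≤g = M.≤-antisym j (M.top j _)
          (subst (λ z → M._≤_ j z (M._∨_ j (h j) (g j))) (pg i gnz j j<i) (proj₁ (proj₂ (M.∨-supremum j (h j) (g j)))))
    where
    gnz : g i ≢ M.0# i
    gnz g0 = nz (M.≤0⇒≡0 i (subst (M._≤_ i _) g0
                 (proj₂ (proj₂ (M.∨-supremum i (h i) (g i))) (g i) h≤g (M.≤-refl i))))
  ... | inj₂ g≤h = M.≤-antisym j (M.top j _)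
          (subst (λ z → M._≤_ j z (M._∨_ j (h j) (g j))) (ph i hnz j j<i) (proj₁ (M.∨-supremum j (h j) (g j))))
    where
    hnz : h i ≢ M.0# i
    hnz h0 = nz (M.≤0⇒≡0 i (subst (M._≤_ i _) h0
                 (proj₂ (proj₂ (M.∨-supremum i (h i) (g i))) (h i) (M.≤-refl i) g≤h)))

  ⇒-closed : ∀ h g → IsProd (h ⇒F g)
  ⇒-closed h g i nz j j<i with em {Below h g i}
  ... | no _ = ⊥-elim (nz refl)
  ... | yes b with em {Below h g j}
  ...   | yes _ = M.≤⇒⇒≡1 j (b j j<i)
  ...   | no ¬bj = ⊥-elim (¬bj (λ k k<j → b k (<-trans k<j j<i)))

  1-closed : IsProd 1F
  1-closed i _ j _ = refl

  _·P_ _⇒P_ _∧P_ _∨P_ : Prod → Prod → Prod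
  (h , ph) ·P (g , pg) = h ·F g , ·-closed h g ph pg
  (h , ph) ∧P (g , pg) = h ∧F g , ∧-closed h g ph pg
  (h , ph) ∨P (g , pg) = h ∨F g , ∨-closed h g ph pg
  (h , ph) ⇒P (g , pg) = h ⇒F g , ⇒-closed h g

  1P : Prod
  1P = 1F , 1-closed

  ProdAlg : SemihoopAlg
  ProdAlg = record
    { Carrier = Prod ; _≈_ = _≈_
    ; _·_ = _·P_ ; _⇒_ = _⇒P_ ; _∧_ = _∧P_ ; _∨_ = _∨P_ ; 1# = 1P }

module _ (F : Forest) where
  open Forest F renaming (Carrier to I; _≤_ to _⊑_)

  IsDownset : (I → Bool) → Set
  IsDownset S = ∀ {i j} → S i ≡ true → j ⊑ i → S j ≡ true

  IsProper : (I → Bool) → Set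
  IsProper S = ∃ λ i → S i ≡ false

  _∖_ : (I → Bool) → Forest
  _∖_ S = record
    { Carrier = Σ I (λ i → S i ≡ false)
    ; _≤_ = λ p q → proj₁ p ⊑ proj₁ q
    ; isPartialOrder = record
      { isPreorder = record
        { isEquivalence = PE.isEquivalence
        ; reflexive = λ { refl → ≤-refl }
        ; trans = ≤-trans }
      ; antisym = λ {p} {q} p≤q q≤p → Σ-≡ (≤-antisym p≤q q≤p) }
    ; downChain = λ a x y → downChain (proj₁ a) (proj₁ x) (proj₁ y) }
    where
    open Decidable⇒UIP _≟B_ using (≡-irrelevant)
    Σ-≡ : ∀ {p q : Σ I (λ i → S i ≡ false)} → proj₁ p ≡ proj₁ q → p ≡ q
    Σ-≡ {i , e} {.i , e'} refl = cong (i ,_) (≡-irrelevant e e')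

module XS (em : ExcludedMiddle 0ℓ) (F : Forest) (M : Forest.Carrier F → MTLChain)
          (S : Forest.Carrier F → Bool) (down : IsDownset F S) where
  open Forest F using (_<_) renaming (Carrier to I)
  open ForestProduct em F M

  OneOnS : Fun → Set
  OneOnS h = ∀ i → S i ≡ true → h i ≡ M.1# i

  X : Set
  X = Σ Prod (λ h → OneOnS (proj₁ h))

  _≈X_ : X → X → Set
  x ≈X y = proj₁ x ≈ proj₁ y

  ·-closedS : ∀ h g → OneOnS h → OneOnS g → OneOnS (h ·F g)
  ·-closedS h g oh og i s = trans (cong₂ (M._·_ i) (oh i s) (og i s)) (M.identityˡ i _)

  ∧-closedS : ∀ h g → OneOnS h → OneOnS g → OneOnS (h ∧F g)
  ∧-closedS h g oh og i s = M.≤-antisym i (M.top i _)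
    (proj₂ (proj₂ (M.∧-infimum i (h i) (g i))) (M.1# i)
      (M.reflexive i (sym (oh i s))) (M.reflexive i (sym (og i s))))

  ∨-closedS : ∀ h g → OneOnS h → OneOnS g → OneOnS (h ∨F g)
  ∨-closedS h g oh og i s = M.≤-antisym i (M.top i _)
    (subst (λ z → M._≤_ i z (M._∨_ i (h i) (g i))) (oh i s) (proj₁ (M.∨-supremum i (h i) (g i))))

  ⇒-closedS : ∀ h g → OneOnS h → OneOnS g → OneOnS (h ⇒F g)
  ⇒-closedS h g oh og i s with em {Below h g i}
  ... | yes _ = M.≤⇒⇒≡1 i (M.reflexive i (trans (oh i s) (sym (og i s))))
  ... | no ¬b = ⊥-elim (¬b (λ j j<i → M.reflexive j
                  (trans (oh j (down s (proj₁ j<i))) (sym (og j (down s (proj₁ j<i)))))))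

  XAlg : SemihoopAlg
  XAlg = record
    { Carrier = X ; _≈_ = _≈X_
    ; _·_ = λ { (h , oh) (g , og) → h ·P g , ·-closedS (proj₁ h) (proj₁ g) oh og }
    ; _⇒_ = λ { (h , oh) (g , og) → h ⇒P g , ⇒-closedS (proj₁ h) (proj₁ g) oh og }
    ; _∧_ = λ { (h , oh) (g , og) → h ∧P g , ∧-closedS (proj₁ h) (proj₁ g) oh og }
    ; _∨_ = λ { (h , oh) (g , og) → h ∨P g , ∨-closedS (proj₁ h) (proj₁ g) oh og }
    ; 1# = 1P , (λ _ _ → refl) }

module Submission where

-- The isomorphism is restriction to F ∖ S; its inverse extends a function on
-- F ∖ S by the constant 1 on S.
-- Products, meets, joins and 1 are pointwise, so restriction preserves them
-- definitionally.

open import Defs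
open MTLChain using () renaming (Carrier to ∣_∣)
open import Level using (0ℓ)
open import Data.Bool using (Bool; true; false)
open import Data.Bool.Properties using () renaming (_≟_ to _≟B_)
open import Data.Product using (Σ; _,_; proj₁; proj₂)
open import Data.Sum using (_⊎_; inj₁; inj₂)
open import Data.Empty using (⊥-elim)
open import Function.Bundles using (_⇔_; mk⇔; Equivalence)
open import Relation.Nullary using (Dec; yes; no)
open import Relation.Binary.PropositionalEquality
  using (_≡_; refl; sym; trans; cong)
open import Axiom.ExcludedMiddle using (ExcludedMiddle)
open import Axiom.UniquenessOfIdentityProofs using (module Decidable⇒UIP)
open Decidable⇒UIP _≟B_ using (≡-irrelevant)

impAt-irrelevant : (em : ExcludedMiddle 0ℓ) (F : Forest) (M : Forest.Carrier F → MTLChain)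
  (h g : ForestProduct.Fun em F M) (i : Forest.Carrier F)
  (d d' : Dec (ForestProduct.Below em F M h g i)) →
  ForestProduct.impAt em F M h g i d ≡ ForestProduct.impAt em F M h g i d'
impAt-irrelevant em F M h g i (yes _) (yes _) = refl
impAt-irrelevant em F M h g i (no _)  (no _)  = refl
impAt-irrelevant em F M h g i (yes b) (no ¬b) = ⊥-elim (¬b b)
impAt-irrelevant em F M h g i (no ¬b) (yes b) = ⊥-elim (¬b b)

module Restriction (em : ExcludedMiddle 0ℓ) (F : Forest) (M : Forest.Carrier F → MTLChain)
    (S : Forest.Carrier F → Bool) (down : IsDownset F S) where
  open Forest F using (_<_) renaming (Carrier to I)
  module P = ForestProduct em F M
  module Q = ForestProduct em (F ∖ S) (λ p → M (proj₁ p))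
  open XS em F M S down
  module M i = MTLChain (M i)

  Out : Set
  Out = Σ I (λ i → S i ≡ false)

  Out-≡ : ∀ {p q : Out} → proj₁ p ≡ proj₁ q → p ≡ q
  Out-≡ {i , e} {.i , e'} refl = cong (i ,_) (≡-irrelevant e e')

  <-restrict : ∀ {p q : Out} → Forest._<_ (F ∖ S) p q → proj₁ p < proj₁ q
  <-restrict (p⊑q , p≢q) = p⊑q , λ eq → p≢q (Out-≡ eq)

  <-lift : ∀ {p q : Out} → proj₁ p < proj₁ q → Forest._<_ (F ∖ S) p q
  <-lift (p⊑q , p≢q) = p⊑q , λ eq → p≢q (cong proj₁ eq)

  side : ∀ i → S i ≡ true ⊎ S i ≡ false
  side i with S i
  ... | true  = inj₁ refl
  ... | false = inj₂ refl

  restrict : P.Fun → Q.Fun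
  restrict h p = h (proj₁ p)

  restrict-prod : ∀ h → P.IsProd h → Q.IsProd (restrict h)
  restrict-prod h ph p nz q q<p = ph (proj₁ p) nz (proj₁ q) (<-restrict q<p)

  extendAt : Q.Fun → ∀ i (b : Bool) → S i ≡ b → ∣ M i ∣
  extendAt g i true  _ = M.1# i
  extendAt g i false s = g (i , s)

  extend : Q.Fun → P.Fun
  extend g i = extendAt g i (S i) refl

  extend-on-S : ∀ g i → S i ≡ true → extend g i ≡ M.1# i
  extend-on-S g i s = on-S (S i) refl s
    where
    on-S : ∀ b (e : S i ≡ b) → b ≡ true → extendAt g i b e ≡ M.1# i
    on-S .true e refl = refl

  extend-off-S : ∀ g i (s : S i ≡ false) → extend g i ≡ g (i , s)
  extend-off-S g i s = off-S (S i) refl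
    where
    off-S : ∀ b (e : S i ≡ b) → extendAt g i b e ≡ g (i , s)
    off-S false e rewrite ≡-irrelevant e s = refl
    off-S true e with trans (sym e) s
    ... | ()

  extend-cong : ∀ {g g' : Q.Prod} → g Q.≈ g' → ∀ i → extend (proj₁ g) i ≡ extend (proj₁ g') i
  extend-cong eq i with side i
  ... | inj₁ s = trans (extend-on-S _ i s) (sym (extend-on-S _ i s))
  ... | inj₂ s = trans (extend-off-S _ i s) (trans (eq (i , s)) (sym (extend-off-S _ i s)))

  -- Extension by 1 stays in the forest product: below a point of S there are
  -- only points of S (downset), and below a point outside S the condition is
  -- inherited from F ∖ S.
  extend-prod : ∀ g → Q.IsProd g → P.IsProd (extend g)
  extend-prod g pg i nz j j<i with side i | side j
  ... | _       | inj₁ sj = extend-on-S g j sj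
  ... | inj₁ si | inj₂ sj with trans (sym (down si (proj₁ j<i))) sj
  ...   | ()
  extend-prod g pg i nz j j<i | inj₂ si | inj₂ sj =
    trans (extend-off-S g j sj)
      (pg (i , si) (λ g0 → nz (trans (extend-off-S g i si) g0)) (j , sj) (<-lift j<i))

  extend-restrict : ∀ h → OneOnS h → ∀ i → extend (restrict h) i ≡ h i
  extend-restrict h oh i with side i
  ... | inj₁ s = trans (extend-on-S _ i s) (sym (oh i s))
  ... | inj₂ s = extend-off-S _ i s

  -- For functions that are 1 on S, comparing them below a point outside S
  -- in F is the same as comparing their restrictions in F ∖ S: on S both
  -- are 1, hence comparable.
  below-restrict : ∀ h g → OneOnS h → OneOnS g → ∀ i (s : S i ≡ false) →
    P.Below h g i ⇔ Q.Below (restrict h) (restrict g) (i , s)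
  below-restrict h g oh og i s = mk⇔ down-to up-from
    where
    down-to : P.Below h g i → Q.Below (restrict h) (restrict g) (i , s)
    down-to b q q<p = b (proj₁ q) (<-restrict q<p)
    up-from : Q.Below (restrict h) (restrict g) (i , s) → P.Below h g i
    up-from b j j<i with side j
    ... | inj₁ sj = M.reflexive j (trans (oh j sj) (sym (og j sj)))
    ... | inj₂ sj = b (j , sj) (<-lift j<i)

  restrict-⇒ : ∀ h g → OneOnS h → OneOnS g → ∀ p →
    restrict (h P.⇒F g) p ≡ (restrict h Q.⇒F restrict g) p
  restrict-⇒ h g oh og (i , s) = decide (em {P.Below h g i})
    where
    open Equivalence (below-restrict h g oh og i s)
    decide : Dec (P.Below h g i) → restrict (h P.⇒F g) (i , s) ≡ (restrict h Q.⇒F restrict g) (i , s)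
    decide (yes b) = trans (impAt-irrelevant em F M h g i em (yes b))
                           (impAt-irrelevant em (F ∖ S) _ _ _ (i , s) (yes (to b)) em)
    decide (no ¬b) = trans (impAt-irrelevant em F M h g i em (no ¬b))
                           (impAt-irrelevant em (F ∖ S) _ _ _ (i , s) (no (λ b → ¬b (from b))) em)

  toQ : X → Q.Prod
  toQ ((h , ph) , _) = restrict h , restrict-prod h ph

  fromQ : Q.Prod → X
  fromQ (g , pg) = (extend g , extend-prod g pg) , (λ i → extend-on-S g i)

  restrict-iso : XAlg ≅ Q.ProdAlg
  restrict-iso = record
    { to        = toQ
    ; from      = fromQ
    ; to-cong   = λ eq p → eq (proj₁ p)
    ; from-cong = λ {g} {g'} → extend-cong {g} {g'}
    ; from∘to   = λ x → extend-restrict (proj₁ (proj₁ x)) (proj₂ x)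
    ; to∘from   = λ y p → extend-off-S (proj₁ y) (proj₁ p) (proj₂ p)
    ; to-·      = λ _ _ _ → refl
    ; to-⇒      = λ { ((h , _) , oh) ((g , _) , og) → restrict-⇒ h g oh og }
    ; to-∧      = λ _ _ _ → refl
    ; to-∨      = λ _ _ _ → refl
    ; to-1      = λ _ → refl
    }

lemma4p7 : (em : ExcludedMiddle 0ℓ) (F : Forest) (M : Forest.Carrier F → MTLChain)
    (S : Forest.Carrier F → Bool) (down : IsDownset F S) → IsProper F S →
    XS.XAlg em F M S down ≅ ForestProduct.ProdAlg em (F ∖ S) (λ p → M (proj₁ p))
lemma4p7 em F M S down _ = Restriction.restrict-iso em F M S down
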